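{- Let $\mathcal{H}=\{G_1,\dots,G_k\}$ be a family of pairwise disjoint non-trivial connected graphs and let $G[\mathcal{H}]$ be a non-bipartite graph obtained by point-attaching from $\mathcal{H}$. Then $$\dim_l(G[\mathcal{H}])=\sum_{j\in J_{\mathcal{H}}}\rho_j.$$
   Context: All graphs are finite, simple. For a connected graph $G$, $d_G(x,y)$ is the length of a shortest $x$–$y$ path. A set $W\subseteq V(G)$ is a local metric generator for $G$ if for every pair of adjacent vertices $u,v$ there is $w\in W$ with $d_G(u,w)\neq d_G(v,w)$. The local metric dimension $\dim_l(G)$ is the minimum cardinality of a local metric generator. Point-attaching: starting from $G_1$, for $i=1,\dots,k-1$, select a vertex of the already constructed graph and a vertex of $G_{i+1}$ and identify them; the result $G[\mathcal{H}]$ is obtained by point-attaching from $G_1,\dots,G_k$, and the $G_i$ (viewed as subgraphs of $G[\mathcal{H}]$) are its primary subgraphs. Attachment vertices are the vertices of $G[\mathcal{H}]$ obtained by identifying vertices of different primary subgraphs. For an attachment vertex $x$ and a primary subgraph $G_j$ with $x\in V(G_j)$, $G_j(x^+)$ is the connected component containing $x$ of the graph obtained from $G[\mathcal{H}]$ by removing all edges joining $x$ to vertices of $G_j$. $J_{\mathcal{H}}$ is the set of indices $j$ with $G_j$ not bipartite. For $j\in J_{\mathcal{H}}$, $C_j$ is the set of attachment vertices $x\in V(G_j)$ such that $G_j(x^+)$ is not bipartite, and $\rho_j=\min\{|S| : S\subseteq V(G_j),\ S\cup C_j \text{ is a local metric generator for } G_j\}$. -}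

module Defs where

open import Data.Nat using (ℕ; zero; suc; _≤_; _<_)
open import Data.Fin using (Fin; toℕ)
open import Data.Fin.Subset using (Subset; _∈_; ∣_∣)
open import Data.Bool using (Bool; true; false)
open import Data.Product using (Σ; ∃; ∃₂; _×_; _,_)
open import Data.Sum using (_⊎_)
open import Data.List using (List; tabulate)
open import Function.Bundles using (_⇔_)
open import Relation.Nullary using (¬_)
open import Relation.Binary.PropositionalEquality using (_≡_; _≢_)

record Graph (n : ℕ) : Set where
  field
    adj        : Fin n → Fin n → Bool
    adj-sym    : ∀ u v → adj u v ≡ adj v u
    adj-irrefl : ∀ u → adj u u ≡ false

Adj : ∀ {n} → Graph n → Fin n → Fin n → Set
Adj G u v = Graph.adj G u v ≡ true

data Walk {n : ℕ} (R : Fin n → Fin n → Set) : Fin n → Fin n → ℕ → Set where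
  []  : ∀ {x} → Walk R x x 0
  _∷_ : ∀ {x y z ℓ} → R x y → Walk R y z ℓ → Walk R x z (suc ℓ)

Connected : ∀ {n} → Graph n → Set
Connected G = ∀ u v → ∃ λ ℓ → Walk (Adj G) u v ℓ

NonTrivial : ∀ {n} → Graph n → Set
NonTrivial {n} G = 2 ≤ n

Bipartite : ∀ {n} → Graph n → Set
Bipartite {n} G = Σ (Fin n → Bool) λ c → ∀ u v → Adj G u v → c u ≢ c v

Dist : ∀ {n} → Graph n → Fin n → Fin n → ℕ → Set
Dist G u v d = Walk (Adj G) u v d × (∀ m → m < d → ¬ Walk (Adj G) u v m)

Resolves : ∀ {n} → Graph n → Fin n → Fin n → Fin n → Set
Resolves G w u v = ∀ a b → Dist G u w a → Dist G v w b → a ≢ b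

IsLocalMetricGenerator : ∀ {n} → Graph n → (Fin n → Set) → Set
IsLocalMetricGenerator {n} G W =
  ∀ u v → Adj G u v → Σ (Fin n) λ w → W w × Resolves G w u v

LocalMetricDimension : ∀ {n} → Graph n → ℕ → Set
LocalMetricDimension {n} G d =
  (Σ (Subset n) λ W → IsLocalMetricGenerator G (_∈ W) × ∣ W ∣ ≡ d)
  × (∀ (W : Subset n) → IsLocalMetricGenerator G (_∈ W) → d ≤ ∣ W ∣)

-- G (on Fin N) is obtained by point-attaching from the
-- graphs Gs 0, …, Gs (k-1) (in this order): each Gs i is embedded
-- injectively as a subgraph (its primary subgraph), the images cover
-- V(G), E(G) is the union of the images of the E(Gs i), and the image of
-- Gs i (i > 0) meets the union of the images of the earlier ones in
-- exactly one vertex (the identified vertex).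

module _ {k : ℕ} {sizes : Fin k → ℕ} (Gs : (i : Fin k) → Graph (sizes i))
         {N : ℕ} (G : Graph N) where

  record PointAttaching : Set where
    field
      emb     : (i : Fin k) → Fin (sizes i) → Fin N
      emb-inj : ∀ i a b → emb i a ≡ emb i b → a ≡ b
      cover   : ∀ x → ∃₂ λ i a → emb i a ≡ x
      edges   : ∀ x y → Adj G x y ⇔
                  (Σ (Fin k) λ i → Σ (Fin (sizes i)) λ a → Σ (Fin (sizes i)) λ b →
                     emb i a ≡ x × emb i b ≡ y × Adj (Gs i) a b)
      attach  : ∀ (i : Fin k) → 0 < toℕ i →
                  Σ (Fin N) λ x →
                    (Σ (Fin k) λ j → Σ (Fin (sizes j)) λ a → toℕ j < toℕ i × emb j a ≡ x)
                    × (Σ (Fin (sizes i)) λ a → emb i a ≡ x)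
                    × (∀ y → (Σ (Fin k) λ j → Σ (Fin (sizes j)) λ a → toℕ j < toℕ i × emb j a ≡ y)
                           → (Σ (Fin (sizes i)) λ a → emb i a ≡ y) → y ≡ x)

module _ {k : ℕ} {sizes : Fin k → ℕ} {Gs : (i : Fin k) → Graph (sizes i)}
         {N : ℕ} {G : Graph N} (P : PointAttaching Gs G) where

  open PointAttaching P

  InPrimary : Fin k → Fin N → Set
  InPrimary j x = Σ (Fin (sizes j)) λ a → emb j a ≡ x

  AttachmentVertex : Fin N → Set
  AttachmentVertex x = Σ (Fin k) λ i → Σ (Fin k) λ j → i ≢ j × InPrimary i x × InPrimary j x

  -- adjacency of G with all edges joining x to vertices of G_j removed
  RemovedAdj : Fin k → Fin N → Fin N → Fin N → Set
  RemovedAdj j x u v =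
    Adj G u v × ¬ (u ≡ x × InPrimary j v) × ¬ (v ≡ x × InPrimary j u)

  -- u lies in G_j(x⁺), the component containing x of that graph
  InPlusComponent : Fin k → Fin N → Fin N → Set
  InPlusComponent j x u = ∃ λ ℓ → Walk (RemovedAdj j x) x u ℓ

  PlusComponentBipartite : Fin k → Fin N → Set
  PlusComponentBipartite j x =
    Σ (Fin N → Bool) λ c → ∀ u v → InPlusComponent j x u → RemovedAdj j x u v → c u ≢ c v

  InC : (j : Fin k) → Fin (sizes j) → Set
  InC j a = AttachmentVertex (emb j a) × ¬ PlusComponentBipartite j (emb j a)

  IsRho : (j : Fin k) → ℕ → Set
  IsRho j r =
    (Σ (Subset (sizes j)) λ S →
        IsLocalMetricGenerator (Gs j) (λ w → w ∈ S ⊎ InC j w) × ∣ S ∣ ≡ r)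
    × (∀ (S : Subset (sizes j)) →
        IsLocalMetricGenerator (Gs j) (λ w → w ∈ S ⊎ InC j w) → r ≤ ∣ S ∣)

-- The primary subgraphs G_j are arranged like the blocks of a tree.  Walks
-- avoiding the edges of G_j never join two vertices of G_j (separation) and
-- odd closed walks localise in single primary subgraphs.  Hence every vertex w
-- has a gate in G_j (the vertex of G_j it reaches without using G_j), with
-- d(a, w) = d_j(a, gate) + d(gate, w); so w resolves an edge of G_j exactly
-- when its gate does inside G_j.
-- Lower bound: the gates of a generator W outside C_j complete C_j in every
-- non-bipartite G_j, and each w ∈ W serves one G_j only; double counting.
-- Upper bound: the union of optimal completions S_j is a generator, because
-- each vertex of C_j is the gate of a vertex of S_i for a deepest odd G_i
-- beyond it.  Classical choices live in the double-negation monad and are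
-- discharged at the end, as everything involved is decidable.

module Submission where

open import Defs
open import Level using (0ℓ)
open import Data.Nat using (ℕ; zero; suc; _+_; _*_; _≤_; _<_; z≤n; s≤s; _<?_; _≤?_; _≟_)
open import Data.Nat.Properties
open import Algebra.Properties.CommutativeSemigroup +-commutativeSemigroup using (interchange)
open import Data.Nat.ListAction using (sum)
open import Data.List using (tabulate)
open import Data.Fin using (Fin; zero; suc; toℕ; fromℕ<)
open import Data.Fin.Properties using (any?; all?; toℕ-injective; toℕ<n; toℕ-fromℕ<)
  renaming (_≟_ to _≟ᶠ_; suc-injective to fsuc-injective)
open import Data.Fin.Subset using (Subset; _∈_; ∣_∣) renaming (⊥ to ∅)
open import Data.Fin.Subset.Properties using (_∈?_; ∣⊥∣≡0; anySubset?)
open import Data.Vec using (_∷_; []; lookup) renaming (tabulate to tabulateᵛ)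
open import Data.Vec.Properties using (lookup∘tabulate; []=⇒lookup; lookup⇒[]=)
open import Data.Bool using (Bool; true; false; not; _xor_; _∧_) renaming (_≟_ to _≟ᵇ_)
open import Data.Bool.Properties
  using (not-distribˡ-xor; not-distribʳ-xor; xor-identityʳ; xor-same; xor-comm; true-xor; not-¬; ¬-not)
open import Data.Unit using (⊤; tt)
open import Data.Product using (Σ; ∃; _×_; _,_; proj₁; proj₂)
open import Data.Sum using (_⊎_; inj₁; inj₂; swap)
open import Data.Empty using (⊥; ⊥-elim)
open import Function using (_∘_)
open import Function.Bundles using (Equivalence)
open import Effect.Monad using (RawMonad)
open import Relation.Nullary using (¬_; Dec; yes; no; does)
open import Relation.Nullary.Decidable
  using (_×-dec_; _→-dec_; ¬?; decidable-stable; ¬¬-excluded-middle; dec-true)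
open import Relation.Nullary.Negation using (¬¬-Monad)
open import Relation.Binary.PropositionalEquality
open import Relation.Binary.Definitions using (tri<; tri≈; tri>)

open RawMonad (¬¬-Monad {a = 0ℓ}) using (_>>=_; pure; _<$>_)

¬¬-∀Fin : ∀ n {Q : Fin n → Set} → (∀ x → ¬ ¬ Q x) → ¬ ¬ (∀ x → Q x)
¬¬-∀Fin zero q = pure λ ()
¬¬-∀Fin (suc n) q = do
  q₀ ← q zero
  qₛ ← ¬¬-∀Fin n (q ∘ suc)
  pure λ { zero → q₀ ; (suc x) → qₛ x }

¬¬-decidable : ∀ n (P : Fin n → Set) → ¬ ¬ (∀ x → Dec (P x))
¬¬-decidable n P = ¬¬-∀Fin n {λ x → Dec (P x)} (λ _ → ¬¬-excluded-middle)

parity : ℕ → Bool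
parity zero = false
parity (suc n) = not (parity n)

parity-+ : ∀ m n → parity (m + n) ≡ parity m xor parity n
parity-+ zero n = refl
parity-+ (suc m) n = trans (cong not (parity-+ m n)) (not-distribˡ-xor (parity m) (parity n))

parity-even-+ : ∀ q l → parity q ≡ false → parity (q + l) ≡ parity l
parity-even-+ q l even = trans (parity-+ q l) (cong (_xor parity l) even)

xor-xor : ∀ a x → (a xor x) xor x ≡ a
xor-xor true true = refl
xor-xor true false = refl
xor-xor false true = refl
xor-xor false false = refl

xor-cancelʳ : ∀ a b x → a xor x ≡ b xor x → a ≡ b
xor-cancelʳ a b x eq = trans (sym (xor-xor a x)) (trans (cong (_xor x) eq) (xor-xor b x))

module _ {n : ℕ} {R : Fin n → Fin n → Set} where

  infixr 5 _++ʷ_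
  _++ʷ_ : ∀ {x y z m l} → Walk R x y m → Walk R y z l → Walk R x z (m + l)
  [] ++ʷ q = q
  (e ∷ p) ++ʷ q = e ∷ (p ++ʷ q)

  _∷ʳ_ : ∀ {x y z m} → Walk R x y m → R y z → Walk R x z (suc m)
  [] ∷ʳ e = e ∷ []
  (d ∷ p) ∷ʳ e = d ∷ (p ∷ʳ e)

  reverseʷ : (∀ {x y} → R x y → R y x) → ∀ {x y m} → Walk R x y m → Walk R y x m
  reverseʷ sym-R [] = []
  reverseʷ sym-R (e ∷ p) = reverseʷ sym-R p ∷ʳ sym-R e

mapʷ : ∀ {n n'} {R : Fin n → Fin n → Set} {S : Fin n' → Fin n' → Set} (f : Fin n → Fin n')
     → (∀ {x y} → R x y → S (f x) (f y))
     → ∀ {x y m} → Walk R x y m → Walk S (f x) (f y) m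
mapʷ f g [] = []
mapʷ f g (e ∷ p) = g e ∷ mapʷ f g p

weakenʷ : ∀ {n} {R S : Fin n → Fin n → Set} → (∀ {x y} → R x y → S x y)
        → ∀ {x y m} → Walk R x y m → Walk S x y m
weakenʷ g = mapʷ (λ x → x) g

minimise : {P : ℕ → Set} → (∀ m → Dec (P m)) → ∀ {n} → P n
         → Σ ℕ λ d → P d × (∀ m → m < d → ¬ P m)
minimise {P} P? {n} = scan 0 n (λ _ ())
  where
  scan : ∀ s t → (∀ m → m < s → ¬ P m) → P (s + t) → Σ ℕ λ d → P d × (∀ m → m < d → ¬ P m)
  scan s t below p with P? s
  ... | yes ps = s , ps , below
  scan s zero below p | no ¬ps = ⊥-elim (¬ps (subst P (+-identityʳ s) p))
  scan s (suc t) below p | no ¬ps = scan (suc s) t below' (subst P (+-suc s t) p)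
    where
    below' : ∀ m → m < suc s → ¬ P m
    below' m m<1+s with m<1+n⇒m<n∨m≡n m<1+s
    ... | inj₁ m<s = below m m<s
    ... | inj₂ refl = ¬ps

argmax : ∀ {n} (D : Fin n → Set) → (∀ i → Dec (D i)) → (f : Fin n → ℕ)
       → Σ (Fin n) D → Σ (Fin n) λ i → D i × (∀ i' → D i' → f i' ≤ f i)
argmax {suc n} D D? f (i₀ , d₀) with any? (λ i → D? (suc i))
... | no none with i₀
...   | zero = zero , d₀ , λ { zero _ → ≤-refl ; (suc i') d → ⊥-elim (none (i' , d)) }
...   | suc i₀' = ⊥-elim (none (i₀' , d₀))
argmax {suc n} D D? f (i₀ , d₀) | yes some
  with argmax (D ∘ suc) (D? ∘ suc) (f ∘ suc) some | D? zero
... | i , d , max | no ¬d₀ = suc i , d , λ { zero d' → ⊥-elim (¬d₀ d') ; (suc i') d' → max i' d' }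
... | i , d , max | yes d₀' with f zero ≤? f (suc i)
...   | yes le = suc i , d , λ { zero _ → le ; (suc i') d' → max i' d' }
...   | no gt = zero , d₀' , λ { zero _ → ≤-refl ; (suc i') d' → ≤-trans (max i' d') (≰⇒≥ gt) }

-- A symmetric relation without odd closed walks at r admits a 2-colouring
-- that is proper on the part reachable from r (colour = parity of a walk from r).
module ComponentColouring {n : ℕ} (R : Fin n → Fin n → Set) (sym-R : ∀ {x y} → R x y → R y x)
                          (r : Fin n) (reachable? : ∀ u → Dec (∃ λ l → Walk R r u l)) where

  OddClosedWalk : Set
  OddClosedWalk = Σ ℕ λ l → Walk R r r l × parity l ≡ true

  colouring : ¬ OddClosedWalk
            → Σ (Fin n → Bool) λ c → ∀ u v → (∃ λ l → Walk R r u l) → R u v → c u ≢ c v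
  colouring noOdd = c , proper
    where
    c : Fin n → Bool
    c u with reachable? u
    ... | yes (l , _) = parity l
    ... | no _ = false
    proper : ∀ u v → (∃ λ l → Walk R r u l) → R u v → c u ≢ c v
    proper u v ru e eq with reachable? u | reachable? v
    ... | no ¬ru | _ = ¬ru ru
    ... | yes _ | no ¬rv = ¬rv (_ , proj₂ ru ∷ʳ e)
    ... | yes (p , wu) | yes (q , wv) =
      noOdd (p + suc q , wu ++ʷ (e ∷ reverseʷ sym-R wv) , odd)
      where
      odd : parity (p + suc q) ≡ true
      odd = begin
        parity (p + suc q)           ≡⟨ parity-+ p (suc q) ⟩
        parity p xor not (parity q)  ≡⟨ cong (λ b → b xor not (parity q)) eq ⟩
        parity q xor not (parity q)  ≡⟨ sym (not-distribʳ-xor (parity q) (parity q)) ⟩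
        not (parity q xor parity q)  ≡⟨ cong not (xor-same (parity q)) ⟩
        true                         ∎
        where open ≡-Reasoning

module GraphFacts {n : ℕ} (G : Graph n) where

  adj-sym : ∀ {x y} → Adj G x y → Adj G y x
  adj-sym {x} {y} e = trans (Graph.adj-sym G y x) e

  adj? : ∀ x y → Dec (Adj G x y)
  adj? x y = Graph.adj G x y ≟ᵇ true

  adj⇒≢ : ∀ {x y} → Adj G x y → x ≢ y
  adj⇒≢ {x} e refl with trans (sym (Graph.adj-irrefl G x)) e
  ... | ()

  walk? : ∀ l u v → Dec (Walk (Adj G) u v l)
  walk? zero u v with u ≟ᶠ v
  ... | yes refl = yes []
  ... | no u≢v = no λ { [] → u≢v refl }
  walk? (suc l) u v with any? (λ y → adj? u y ×-dec walk? l y v)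
  ... | yes (y , e , w) = yes (e ∷ w)
  ... | no ¬w = no λ { (e ∷ w) → ¬w (_ , e , w) }

  dist-from-walk : ∀ {u v l} → Walk (Adj G) u v l → Σ ℕ (Dist G u v)
  dist-from-walk {u} {v} w with minimise (λ m → walk? m u v) w
  ... | d , wd , shortest = d , wd , shortest

  dist-unique : ∀ {u v a b} → Dist G u v a → Dist G u v b → a ≡ b
  dist-unique {a = a} {b} (wa , ma) (wb , mb) with <-cmp a b
  ... | tri< a<b _ _ = ⊥-elim (mb a a<b wa)
  ... | tri≈ _ a≡b _ = a≡b
  ... | tri> _ _ b<a = ⊥-elim (ma b b<a wb)

  dist-≤-walk : ∀ {u v d m} → Dist G u v d → Walk (Adj G) u v m → d ≤ m
  dist-≤-walk {d = d} {m} (_ , shortest) w with m <? d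
  ... | yes m<d = ⊥-elim (shortest m m<d w)
  ... | no m≮d = ≮⇒≥ m≮d

  shortest-walk : ∀ {u v d} → Walk (Adj G) u v d → (∀ {m} → Walk (Adj G) u v m → d ≤ m) → Dist G u v d
  shortest-walk w lower = w , λ m m<d w' → <⇒≱ m<d (lower w')

  dist-sym : ∀ {u v d} → Dist G u v d → Dist G v u d
  dist-sym (wd , shortest) = reverseʷ adj-sym wd , λ m m<d w → shortest m m<d (reverseʷ adj-sym w)

  dist-zero : ∀ u → Dist G u u 0
  dist-zero u = [] , λ _ ()

  dist-pos : ∀ {u v d} → u ≢ v → Dist G u v d → 0 < d
  dist-pos u≢v ([] , _) = ⊥-elim (u≢v refl)
  dist-pos u≢v (_ ∷ _ , _) = s≤s z≤n

  dist-adj : ∀ {u v w a b} → Adj G u v → Dist G u w a → Dist G v w b → a ≤ suc b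
  dist-adj e da (wb , _) = dist-≤-walk da (e ∷ wb)

  colour-walk : (c : Fin n → Bool) → (∀ u v → Adj G u v → c u ≢ c v)
              → ∀ {a b l} → Walk (Adj G) a b l → c b ≡ c a xor parity l
  colour-walk c proper {a} [] = sym (xor-identityʳ (c a))
  colour-walk c proper {a} {b} (_∷_ {y = y} {ℓ = l} e w) = begin
    c b                       ≡⟨ colour-walk c proper w ⟩
    c y xor parity l          ≡⟨ cong (_xor parity l) (¬-not (λ eq → proper a y e (sym eq))) ⟩
    not (c a) xor parity l    ≡⟨ sym (not-distribˡ-xor (c a) (parity l)) ⟩
    not (c a xor parity l)    ≡⟨ not-distribʳ-xor (c a) (parity l) ⟩
    c a xor not (parity l)    ∎
    where open ≡-Reasoning

  bipartite-resolves : Bipartite G → ∀ g a b → Adj G a b → Resolves G g a b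
  bipartite-resolves (c , proper) g a b e p q (wp , _) (wq , _) refl =
    proper a b e (xor-cancelʳ (c a) (c b) (parity p)
      (trans (sym (colour-walk c proper wp)) (colour-walk c proper wq)))

  odd-closed-walk⇒¬bipartite : ∀ {a l} → Walk (Adj G) a a l → parity l ≡ true → ¬ Bipartite G
  odd-closed-walk⇒¬bipartite {a} {l} w odd (c , proper) =
    not-¬ refl (trans (colour-walk c proper w)
               (trans (cong (c a xor_) odd) (trans (xor-comm (c a) true) (true-xor (c a)))))

  module Distances (connected : Connected G) where

    dist : Fin n → Fin n → ℕ
    dist u v = proj₁ (dist-from-walk (proj₂ (connected u v)))

    dist-ok : ∀ u v → Dist G u v (dist u v)
    dist-ok u v = proj₂ (dist-from-walk (proj₂ (connected u v)))

    dist-comm : ∀ u v → dist u v ≡ dist v u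
    dist-comm u v = dist-unique (dist-ok u v) (dist-sym (dist-ok v u))

    resolves? : ∀ w u v → Dec (Resolves G w u v)
    resolves? w u v with dist u w ≟ dist v w
    ... | yes eq = no λ res → res _ _ (dist-ok u w) (dist-ok v w) eq
    ... | no neq = yes λ a b da db a≡b →
      neq (trans (dist-unique (dist-ok u w) da) (trans a≡b (dist-unique db (dist-ok v w))))

    -- a single vertex resolving every edge forces bipartiteness:
    -- colour each vertex by the parity of its distance to that vertex
    single-resolver⇒bipartite : ∀ g → (∀ u v → Adj G u v → Resolves G g u v) → Bipartite G
    single-resolver⇒bipartite g res = (λ u → parity (dist u g)) , proper
      where
      proper : ∀ u v → Adj G u v → parity (dist u g) ≢ parity (dist v g)
      proper u v e eq with dist u g | dist v g | dist-ok u g | dist-ok v g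
      ... | a | b | da | db with dist-adj e da db | dist-adj (adj-sym e) db da | <-cmp a b
      ...   | _ | _ | tri≈ _ a≡b _ = res u v e a b da db a≡b
      ...   | _ | b≤1+a | tri< a<b _ _ rewrite ≤-antisym b≤1+a a<b = not-¬ refl eq
      ...   | a≤1+b | _ | tri> _ _ b<a rewrite ≤-antisym a≤1+b b<a = not-¬ refl (sym eq)

-- A walk between two vertices of VB using both
-- kinds of edges can only enter side A through c, so its A-excursions are closed
-- walks at c; dropping them gives a B-walk of the same parity, unless one of
-- them is odd, in which case side A has an odd closed walk at c that the
-- original walk reaches.
module CutVertex {n : ℕ} (A B : Fin n → Fin n → Set) (VA VB : Fin n → Set) (c : Fin n)
  (A-src : ∀ {x y} → A x y → VA x) (A-tgt : ∀ {x y} → A x y → VA y)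
  (B-src : ∀ {x y} → B x y → VB x) (B-tgt : ∀ {x y} → B x y → VB y)
  (cut : ∀ {x} → VA x → VB x → x ≡ c) where

  A∪B : Fin n → Fin n → Set
  A∪B x y = A x y ⊎ B x y

  OddLoop : Set
  OddLoop = Σ ℕ λ l → Walk A c c l × parity l ≡ true

  Shortcut : Fin n → Fin n → ℕ → Set
  Shortcut x y l = Σ ℕ λ l' → Walk B x y l'
                   × (parity l' ≡ parity l ⊎ (OddLoop × ∃ λ p → Walk A∪B x c p))

  mutual
    shortcut : ∀ {x y l} → VB x → VB y → Walk A∪B x y l → Shortcut x y l
    shortcut vx vy [] = 0 , [] , inj₁ refl
    shortcut vx vy (inj₂ e ∷ w) with shortcut (B-tgt e) vy w
    ... | l' , w' , inj₁ same = suc l' , e ∷ w' , inj₁ (cong not same)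
    ... | l' , w' , inj₂ (odd , p , wc) = suc l' , e ∷ w' , inj₂ (odd , suc p , inj₂ e ∷ wc)
    shortcut vx vy (inj₁ e ∷ w) with cut (A-src e) vx
    ... | refl = excursion 1 (A-tgt e) (e ∷ []) vy w

    -- inside an A-excursion that left c and has so far followed `run` (length q)
    excursion : ∀ q {a y l} → VA a → Walk A c a q → VB y → Walk A∪B a y l → Shortcut c y (q + l)
    excursion q va run vy [] with cut va vy
    ... | refl with parity q in pq
    ...   | true = 0 , [] , inj₂ ((q , run , pq) , 0 , [])
    ...   | false = 0 , [] , inj₁ (sym (parity-even-+ q 0 pq))
    excursion q va run vy (_∷_ {ℓ = l} (inj₁ e) w) =
      subst (Shortcut c _) (sym (+-suc q l)) (excursion (suc q) (A-tgt e) (run ∷ʳ e) vy w)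
    excursion q va run vy (_∷_ {ℓ = l} (inj₂ e) w) with cut va (B-src e)
    ... | refl with shortcut (B-tgt e) vy w
    ...   | l' , w' , info with parity q in pq
    ...     | true = suc l' , e ∷ w' , inj₂ ((q , run , pq) , 0 , [])
    ...     | false with info
    ...       | inj₁ same = suc l' , e ∷ w' , inj₁ (trans (cong not same) (sym (parity-even-+ q (suc l) pq)))
    ...       | inj₂ (odd , p , wc) = suc l' , e ∷ w' , inj₂ (odd , suc p , inj₂ e ∷ wc)

module Attaching {k : ℕ} {sizes : Fin k → ℕ} (Gs : (i : Fin k) → Graph (sizes i))
                 {N : ℕ} (G : Graph N) (P : PointAttaching Gs G) where

  open PointAttaching P public

  V : Fin k → Fin N → Set
  V = InPrimary P

  V? : ∀ i x → Dec (V i x)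
  V? i x = any? (λ a → emb i a ≟ᶠ x)

  EdgeOf : Fin k → Fin N → Fin N → Set
  EdgeOf i x y = Σ (Fin (sizes i)) λ a → Σ (Fin (sizes i)) λ b →
                   emb i a ≡ x × emb i b ≡ y × Adj (Gs i) a b

  EdgeIn : (Fin k → Set) → Fin N → Fin N → Set
  EdgeIn Q x y = Σ (Fin k) λ i → Q i × EdgeOf i x y

  Avoiding : Fin k → Fin N → Fin N → Set
  Avoiding j = EdgeIn (λ i → i ≢ j)

  Earlier : ℕ → Fin N → Set
  Earlier t x = Σ (Fin k) λ j → Σ (Fin (sizes j)) λ a → toℕ j < t × emb j a ≡ x

  Earlier? : ∀ t x → Dec (Earlier t x)
  Earlier? t x = any? (λ j → any? (λ a → (toℕ j <? t) ×-dec (emb j a ≟ᶠ x)))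

  edgeOf-sym : ∀ {i x y} → EdgeOf i x y → EdgeOf i y x
  edgeOf-sym {i} (a , b , ea , eb , e) = b , a , eb , ea , trans (Graph.adj-sym (Gs i) b a) e

  edgeIn-sym : ∀ {Q x y} → EdgeIn Q x y → EdgeIn Q y x
  edgeIn-sym (i , q , e) = i , q , edgeOf-sym e

  edgeOf-src : ∀ {i x y} → EdgeOf i x y → V i x
  edgeOf-src (a , _ , ea , _) = a , ea

  edgeOf-tgt : ∀ {i x y} → EdgeOf i x y → V i y
  edgeOf-tgt (_ , b , _ , eb , _) = b , eb

  edgeOf⇒adj : ∀ {i x y} → EdgeOf i x y → Adj G x y
  edgeOf⇒adj {i} {x} {y} (a , b , ea , eb , e) = Equivalence.from (edges x y) (i , a , b , ea , eb , e)

  adj⇒edgeOf : ∀ {x y} → Adj G x y → Σ (Fin k) λ i → EdgeOf i x y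
  adj⇒edgeOf {x} {y} e with Equivalence.to (edges x y) e
  ... | i , a , b , ea , eb , e' = i , a , b , ea , eb , e'

  edgeIn⇒adj : ∀ {Q x y} → EdgeIn Q x y → Adj G x y
  edgeIn⇒adj (_ , _ , e) = edgeOf⇒adj e

  embed-edge : ∀ i {a b} → Adj (Gs i) a b → Adj G (emb i a) (emb i b)
  embed-edge i {a} {b} e = edgeOf⇒adj (a , b , refl , refl , e)

  meet-earlier : ∀ i → 0 < toℕ i → Σ (Fin N) λ z → ∀ {x} → Earlier (toℕ i) x → V i x → x ≡ z
  meet-earlier i 0<i with attach i 0<i
  ... | z , _ , _ , unique = z , λ {x} ex vx → unique x ex vx

  share-one : ∀ {i j x y} → i ≢ j → V i x → V j x → V i y → V j y → x ≡ y
  share-one {i} {j} {x} {y} i≢j (a , ea) (b , eb) (c , ec) (d , ed) with <-cmp (toℕ i) (toℕ j)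
  ... | tri≈ _ i≡j _ = ⊥-elim (i≢j (toℕ-injective i≡j))
  ... | tri< i<j _ _ = let z , meet = meet-earlier j (≤-<-trans z≤n i<j)
                       in trans (meet (i , a , i<j , ea) (b , eb)) (sym (meet (i , c , i<j , ec) (d , ed)))
  ... | tri> _ _ j<i = let z , meet = meet-earlier i (≤-<-trans z≤n j<i)
                       in trans (meet (j , b , j<i , eb) (a , ea)) (sym (meet (j , d , j<i , ed) (c , ec)))

  -- The primary subgraphs of index below M+1 are those below M together
  -- with the subgraph of index M, which meets them in at most one vertex.
  module Layer (M : ℕ) (M<k : M < k) (Q : Fin k → Set) where

    top : Fin k
    top = fromℕ< M<k

    top-index : toℕ top ≡ M
    top-index = toℕ-fromℕ< M<k

    Below : Fin k → Set
    Below i = toℕ i < M × Q i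

    TopEdge : Fin N → Fin N → Set
    TopEdge x y = Q top × EdgeOf top x y

    peel : ∀ {x y} → EdgeIn (λ i → toℕ i < suc M × Q i) x y → TopEdge x y ⊎ EdgeIn Below x y
    peel (i , (i<1+M , q) , e) with m<1+n⇒m<n∨m≡n i<1+M
    ... | inj₁ i<M = inj₂ (i , (i<M , q) , e)
    ... | inj₂ i≡M with toℕ-injective (trans i≡M (sym top-index))
    ...   | refl = inj₁ (q , e)

    below-src : ∀ {x y} → EdgeIn Below x y → Earlier M x
    below-src (i , (i<M , _) , a , _ , ea , _) = i , a , i<M , ea

    below-tgt : ∀ {x y} → EdgeIn Below x y → Earlier M y
    below-tgt (i , (i<M , _) , _ , b , _ , eb , _) = i , b , i<M , eb

    top-src : ∀ {x y} → TopEdge x y → V top x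
    top-src (_ , e) = edgeOf-src e

    top-tgt : ∀ {x y} → TopEdge x y → V top y
    top-tgt (_ , e) = edgeOf-tgt e

    -- the vertex where the top subgraph meets the earlier ones
    -- (the given default is used when there are no earlier ones)
    cut-point : Fin N → Σ (Fin N) λ z → ∀ {x} → Earlier M x → V top x → x ≡ z
    cut-point default with 0 <? M
    ... | no 0≮M = default , λ { (_ , _ , j<M , _) _ → ⊥-elim (0≮M (≤-<-trans z≤n j<M)) }
    ... | yes 0<M with meet-earlier top (subst (0 <_) (sym top-index) 0<M)
    ...   | z , meet = z , λ ex vx → meet (subst (λ t → Earlier t _) (sym top-index) ex) vx

    top-odd : ∀ {c l} → Walk TopEdge c c l → parity l ≡ true
            → Q top × Σ ℕ λ l → Walk (EdgeOf top) c c l × parity l ≡ true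
    top-odd [] ()
    top-odd w@((q , _) ∷ _) odd = q , _ , weakenʷ proj₂ w , odd

    join : ∀ {x y} → TopEdge x y ⊎ EdgeIn Below x y → EdgeIn Q x y
    join (inj₁ (q , e)) = top , q , e
    join (inj₂ (i , (_ , q) , e)) = i , q , e

  walk-src : ∀ {Q x y l} → Walk (EdgeIn Q) x y (suc l) → Σ (Fin k) λ i → Q i × V i x
  walk-src ((i , q , e) ∷ _) = i , q , edgeOf-src e

  walk-tgt : ∀ {Q x y l} → Walk (EdgeIn Q) x y (suc l) → Σ (Fin k) λ i → Q i × V i y
  walk-tgt ((i , q , e) ∷ []) = i , q , edgeOf-tgt e
  walk-tgt (_ ∷ w@(_ ∷ _)) = walk-tgt w

  -- Induction over the attaching order: the subgraph of
  -- index M is entered and left through its attachment vertex only.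
  separation : ∀ j {x y l} → V j x → V j y → Walk (Avoiding j) x y l → x ≡ y
  separation j vx vy w =
    separation-below k ≤-refl vx vy (weakenʷ (λ { (i , i≢j , e) → i , (toℕ<n i , i≢j) , e }) w)
    where
    separation-below : ∀ M → M ≤ k → ∀ {x y l} → V j x → V j y
                     → Walk (EdgeIn (λ i → toℕ i < M × i ≢ j)) x y l → x ≡ y
    separation-below zero _ vx vy [] = refl
    separation-below zero _ vx vy ((_ , (() , _) , _) ∷ _)
    separation-below (suc M) 1+M≤k {x} {y} vx vy w with <-cmp (toℕ j) M
    ... | tri≈ _ j≡M _ = separation-below M (<⇒≤ 1+M≤k) vx vy (weakenʷ lower w)
      where
      lower : ∀ {u v} → EdgeIn (λ i → toℕ i < suc M × i ≢ j) u v
            → EdgeIn (λ i → toℕ i < M × i ≢ j) u v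
      lower (i , (i<1+M , i≢j) , e) with m<1+n⇒m<n∨m≡n i<1+M
      ... | inj₁ i<M = i , (i<M , i≢j) , e
      ... | inj₂ i≡M = ⊥-elim (i≢j (toℕ-injective (trans i≡M (sym j≡M))))
    ... | tri> _ _ M<j = both-at-attachment w
      where
      -- all edges lie in earlier subgraphs, which G_j meets in one vertex only
      earlier : ∀ {u} → (Σ (Fin k) λ i → (toℕ i < suc M × i ≢ j) × V i u) → Earlier (toℕ j) u
      earlier (i , (i<1+M , _) , a , ea) = i , a , ≤-trans i<1+M M<j , ea
      both-at-attachment : ∀ {l} → Walk (EdgeIn (λ i → toℕ i < suc M × i ≢ j)) x y l → x ≡ y
      both-at-attachment [] = refl
      both-at-attachment w@(_ ∷ _) =
        let _ , meet = meet-earlier j (≤-<-trans z≤n M<j)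
        in trans (meet (earlier (walk-src w)) vx) (sym (meet (earlier (walk-tgt w)) vy))
    ... | tri< j<M _ _ = separation-below M (<⇒≤ 1+M≤k) vx vy (proj₁ (proj₂ bypass))
      where
      open Layer M 1+M≤k (λ i → i ≢ j)
      earlier : ∀ {u} → V j u → Earlier M u
      earlier (a , ea) = j , a , j<M , ea
      open CutVertex TopEdge (EdgeIn Below) (V top) (Earlier M) (proj₁ (cut-point x))
                     top-src top-tgt below-src below-tgt (λ va vb → proj₂ (cut-point x) vb va)
      bypass = shortcut (earlier vx) (earlier vy) (weakenʷ peel w)

  OddIn : Fin k → Fin N → Set
  OddIn i c = Σ ℕ λ l → Walk (EdgeOf i) c c l × parity l ≡ true

  ReachesOdd : (Fin k → Set) → Fin N → Set
  ReachesOdd Q x = Σ (Fin k) λ i → Q i × Σ (Fin N) λ c → OddIn i c × ∃ λ p → Walk (EdgeIn Q) x c p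

  -- Induction over the attaching order,
  -- splitting the walk at the attachment vertex of the last subgraph.
  localise-odd : ∀ Q {x l} → Walk (EdgeIn Q) x x l → parity l ≡ true → ReachesOdd Q x
  localise-odd Q w odd =
    localise-below k ≤-refl (weakenʷ (λ { (i , q , e) → i , (toℕ<n i , q) , e }) w) odd
    where
    localise-below : ∀ M → M ≤ k → ∀ {x l} → Walk (EdgeIn (λ i → toℕ i < M × Q i)) x x l
                   → parity l ≡ true → ReachesOdd Q x
    localise-below zero _ [] ()
    localise-below zero _ ((_ , (() , _) , _) ∷ _) _
    localise-below (suc M) 1+M≤k {x} {l} w odd with Earlier? M x
    ... | yes ex = from-below ex
      where
      open Layer M 1+M≤k Q
      open CutVertex TopEdge (EdgeIn Below) (V top) (Earlier M) (proj₁ (cut-point x))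
                     top-src top-tgt below-src below-tgt (λ va vb → proj₂ (cut-point x) vb va)
      -- x lies in an earlier subgraph; excursions into the top one are closed at its cut point
      from-below : Earlier M x → ReachesOdd Q x
      from-below ex with shortcut ex ex (weakenʷ peel w)
      ... | _ , w' , inj₁ same = localise-below M (<⇒≤ 1+M≤k) w' (trans same odd)
      ... | _ , _ , inj₂ ((_ , run , odd-run) , _ , wc) =
        let q , o = top-odd run odd-run in top , q , _ , o , _ , weakenʷ join wc
    ... | no ¬ex = from-top (first-in-top w odd)
      where
      open Layer M 1+M≤k Q
      open CutVertex (EdgeIn Below) TopEdge (Earlier M) (V top) (proj₁ (cut-point x))
                     below-src below-tgt top-src top-tgt (proj₂ (cut-point x))
      -- the walk is nonempty and cannot start with an earlier edge
      first-in-top : ∀ {l} → Walk (EdgeIn (λ i → toℕ i < suc M × Q i)) x x l → parity l ≡ true → V top x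
      first-in-top [] ()
      first-in-top (e ∷ _) _ with peel e
      ... | inj₁ e' = top-src e'
      ... | inj₂ e' = ⊥-elim (¬ex (below-src e'))
      -- x lies only in the top subgraph; excursions into earlier ones are closed at the cut point
      from-top : V top x → ReachesOdd Q x
      from-top vx with shortcut vx vx (weakenʷ (swap ∘ peel) w)
      ... | _ , w' , inj₁ same = let q , o = top-odd w' (trans same odd) in top , q , x , o , 0 , []
      ... | _ , _ , inj₂ ((_ , run , odd-run) , _ , wc) with localise-below M (<⇒≤ 1+M≤k) run odd-run
      ...   | i , q , c' , o , _ , wc' = i , q , c' , o , _ , weakenʷ (join ∘ swap) wc ++ʷ wc'

-- Metric structure of a graph obtained by point-attaching connected graphs.
-- There is at least one primary subgraph, G_0, which serves as a root.
module Gates {k : ℕ} {sizes : Fin (suc k) → ℕ} (Gs : (i : Fin (suc k)) → Graph (sizes i))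
             (nontrivial : ∀ i → NonTrivial (Gs i)) (connected : ∀ i → Connected (Gs i))
             {N : ℕ} (G : Graph N) (P : PointAttaching Gs G) where

  open Attaching Gs G P public
  open GraphFacts G public
  module Piece (j : Fin (suc k)) = GraphFacts (Gs j)
  module PieceDist (j : Fin (suc k)) = GraphFacts.Distances (Gs j) (connected j)

  some-vertex : ∀ i → Fin (sizes i)
  some-vertex i = fromℕ< {0} (≤-trans (s≤s z≤n) (nontrivial i))

  embed-walk : ∀ i {a b l} → Walk (Adj (Gs i)) a b l → Walk (EdgeOf i) (emb i a) (emb i b) l
  embed-walk i = mapʷ (emb i) (λ {a} {b} e → a , b , refl , refl , e)

  path-in : ∀ i a b → ∃ λ l → Walk (Adj G) (emb i a) (emb i b) l
  path-in i a b = _ , weakenʷ edgeOf⇒adj (embed-walk i (proj₂ (connected i a b)))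

  avoiding-path : ∀ i j → i ≢ j → ∀ a b → ∃ λ l → Walk (Avoiding j) (emb i a) (emb i b) l
  avoiding-path i j i≢j a b = _ , weakenʷ (λ e → i , i≢j , e) (embed-walk i (proj₂ (connected i a b)))

  restrict-walk : ∀ i {x y l} → Walk (EdgeOf i) x y l → ∀ {a b} → x ≡ emb i a → y ≡ emb i b
                → Walk (Adj (Gs i)) a b l
  restrict-walk i [] {a} {b} ea eb with emb-inj i a b (trans (sym ea) eb)
  ... | refl = []
  restrict-walk i ((a' , _ , ea' , eb' , e) ∷ w) {a} ea eb with emb-inj i a' a (trans ea' ea)
  ... | refl = e ∷ restrict-walk i w (sym eb') eb

  -- G is connected: every vertex is reachable from a vertex of G_0,
  -- by induction on the index of its primary subgraph
  root : Fin N
  root = emb zero (some-vertex zero)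

  reach-piece : ∀ fuel i → toℕ i < fuel → ∀ a → ∃ λ l → Walk (Adj G) root (emb i a) l
  reach-piece (suc fuel) zero _ a = path-in zero (some-vertex zero) a
  reach-piece (suc fuel) (suc i) i<fuel a with attach (suc i) (s≤s z≤n)
  ... | x , (j , a' , j<i , ea') , (a'' , ea'') , _ with reach-piece fuel j (≤-trans j<i (≤-pred i<fuel)) a'
  ...   | _ , to-j = _ , subst (λ v → Walk (Adj G) root v _) (trans ea' (sym ea'')) to-j
                           ++ʷ proj₂ (path-in (suc i) a'' a)

  reach : ∀ v → ∃ λ l → Walk (Adj G) root v l
  reach v with cover v
  ... | i , a , refl = reach-piece (suc (toℕ i)) i ≤-refl a

  G-connected : Connected G
  G-connected u v = _ , reverseʷ adj-sym (proj₂ (reach u)) ++ʷ proj₂ (reach v)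

  open GraphFacts.Distances G G-connected public

  FirstVisit : (j : Fin (suc k)) → Fin N → Fin N → ℕ → Set
  FirstVisit j u t l = Σ (Fin (sizes j)) λ a → Σ ℕ λ l₁ → Σ ℕ λ l₂ → l₁ + l₂ ≡ l
                       × Walk (Avoiding j) u (emb j a) l₁ × Walk (Adj G) (emb j a) t l₂

  first-visit : ∀ j {u t l} → Walk (Adj G) u t l → Walk (Avoiding j) u t l ⊎ FirstVisit j u t l
  first-visit j {u} {l = l} w with V? j u
  ... | yes (a , refl) = inj₂ (a , 0 , l , refl , [] , w)
  first-visit j [] | no _ = inj₁ []
  first-visit j (e ∷ w) | no u∉Gj with adj⇒edgeOf e
  ... | i , e' with i ≟ᶠ j
  ...   | yes refl = ⊥-elim (u∉Gj (edgeOf-src e'))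
  ...   | no i≢j with first-visit j w
  ...     | inj₁ avoid = inj₁ ((i , i≢j , e') ∷ avoid)
  ...     | inj₂ (a , l₁ , l₂ , eq , pre , rest) =
                inj₂ (a , suc l₁ , l₂ , cong suc eq , (i , i≢j , e') ∷ pre , rest)

  -- The gate of w in G_j: the vertex of G_j that w reaches without using
  -- edges of G_j.  It exists by connectivity and is unique by separation.
  gate-exists : ∀ j w → Σ (Fin (sizes j)) λ g → ∃ λ l → Walk (Avoiding j) w (emb j g) l
  gate-exists j w with first-visit j (proj₂ (G-connected w (emb j (some-vertex j))))
  ... | inj₁ avoid = some-vertex j , _ , avoid
  ... | inj₂ (a , l₁ , _ , _ , pre , _) = a , l₁ , pre

  gate : (j : Fin (suc k)) → Fin N → Fin (sizes j)
  gate j w = proj₁ (gate-exists j w)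

  gate-walk : ∀ j w → ∃ λ l → Walk (Avoiding j) w (emb j (gate j w)) l
  gate-walk j w = proj₂ (gate-exists j w)

  gate-unique : ∀ j {w a l} → Walk (Avoiding j) w (emb j a) l → a ≡ gate j w
  gate-unique j {a = a} w = emb-inj j _ _
    (separation j (a , refl) (gate j _ , refl) (reverseʷ edgeIn-sym w ++ʷ proj₂ (gate-walk j _)))

  gate-self : ∀ j a → gate j (emb j a) ≡ a
  gate-self j a = sym (gate-unique j [])

  gate-move : ∀ j {x v l} → Walk (Avoiding j) x v l → gate j v ≡ gate j x
  gate-move j w = gate-unique j (w ++ʷ proj₂ (gate-walk j _))

  ThroughGate : (j : Fin (suc k)) → Fin N → Fin N → ℕ → Set
  ThroughGate j p w l = Σ ℕ λ l₁ → Σ ℕ λ l₂ → l₁ + l₂ ≡ l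
    × Walk (Adj G) p (emb j (gate j w)) l₁ × Walk (Adj G) (emb j (gate j w)) w l₂

  through-gate : ∀ j {p w l} → Walk (Adj G) p w l
               → (∃ λ l' → Walk (Avoiding j) p w l') ⊎ ThroughGate j p w l
  through-gate j w with first-visit j (reverseʷ adj-sym w)
  ... | inj₁ avoid = inj₁ (_ , reverseʷ edgeIn-sym avoid)
  ... | inj₂ (a , l₁ , l₂ , eq , pre , rest) with gate-unique j pre
  ...   | refl = inj₂ (l₂ , l₁ , trans (+-comm l₂ l₁) eq , reverseʷ adj-sym rest ,
                       reverseʷ adj-sym (weakenʷ edgeIn⇒adj pre))

  -- G_j is isometric in G: a walk in G between vertices of G_j can be
  -- replaced by a walk in G_j that is no longer (detours return by separation)
  isometric : ∀ j {a b l} → Walk (Adj G) (emb j a) (emb j b) l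
            → Σ ℕ λ m → m ≤ l × Walk (Adj (Gs j)) a b m
  isometric j {a} w = resume a [] w
    where
    -- `detour` is the avoiding walk taken since last leaving G_j at emb j h
    resume : ∀ h {c b q l} → Walk (Avoiding j) (emb j h) c q → Walk (Adj G) c (emb j b) l
           → Σ ℕ λ m → m ≤ l × Walk (Adj (Gs j)) h b m
    resume h {b = b} detour [] with emb-inj j _ _ (separation j (h , refl) (b , refl) detour)
    ... | refl = 0 , z≤n , []
    resume h detour (e ∷ rest) with adj⇒edgeOf e
    ... | i , (a' , b' , refl , refl , e') with i ≟ᶠ j
    ...   | no i≢j with resume h (detour ∷ʳ (i , i≢j , (a' , b' , refl , refl , e'))) rest
    ...     | m , m≤l , w = m , m≤n⇒m≤1+n m≤l , w
    resume h detour (e ∷ rest) | i , (a' , b' , refl , refl , e') | yes refl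
      with emb-inj i _ _ (separation i (h , refl) (a' , refl) detour)
    ...     | refl with resume b' [] rest
    ...       | m , m≤l , w = suc m , s≤s m≤l , e' ∷ w

  dist-in : (j : Fin (suc k)) → Fin (sizes j) → Fin (sizes j) → ℕ
  dist-in j = PieceDist.dist j

  dist-via-gate : ∀ j a w → Dist G (emb j a) w (dist-in j a (gate j w) + dist (emb j (gate j w)) w)
  dist-via-gate j a w = shortest-walk (inner ++ʷ outer) lower
    where
    g = gate j w
    inner = weakenʷ edgeOf⇒adj (embed-walk j (proj₁ (PieceDist.dist-ok j a g)))
    outer = proj₁ (dist-ok (emb j g) w)
    lower : ∀ {m} → Walk (Adj G) (emb j a) w m → dist-in j a g + dist (emb j g) w ≤ m
    lower wm with through-gate j wm
    ... | inj₁ (_ , avoid) with gate-unique j (reverseʷ edgeIn-sym avoid)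
    ...   | refl = subst (λ d → d + dist (emb j g) w ≤ _)
                     (sym (Piece.dist-unique j (PieceDist.dist-ok j a a) (Piece.dist-zero j a)))
                     (dist-≤-walk (dist-ok (emb j a) w) wm)
    lower wm | inj₂ (m₁ , m₂ , refl , w₁ , w₂) with isometric j w₁
    ... | m' , m'≤m₁ , w₁' = +-mono-≤ (≤-trans (Piece.dist-≤-walk j (PieceDist.dist-ok j a g) w₁') m'≤m₁)
                                      (dist-≤-walk (dist-ok (emb j g) w) w₂)

  resolves-from-gate : ∀ j {a b t} w → gate j w ≡ t → Resolves (Gs j) t a b → Resolves G w (emb j a) (emb j b)
  resolves-from-gate j {a} {b} w refl res da db dA dB eq =
    res _ _ (PieceDist.dist-ok j a g) (PieceDist.dist-ok j b g)
      (+-cancelʳ-≡ (dist (emb j g) w) _ _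
        (trans (sym (dist-unique dA (dist-via-gate j a w))) (trans eq (dist-unique dB (dist-via-gate j b w)))))
    where g = gate j w

  resolves-to-gate : ∀ j {a b} w → Resolves G w (emb j a) (emb j b) → Resolves (Gs j) (gate j w) a b
  resolves-to-gate j {a} {b} w res p q dp dq eq =
    res _ _ (dist-via-gate j a w) (dist-via-gate j b w)
      (cong (_+ dist (emb j g) w)
        (trans (Piece.dist-unique j (PieceDist.dist-ok j a g) dp)
               (trans eq (Piece.dist-unique j dq (PieceDist.dist-ok j b g)))))
    where g = gate j w

module OddCycles {k : ℕ} {sizes : Fin (suc k) → ℕ} (Gs : (i : Fin (suc k)) → Graph (sizes i))
             (nontrivial : ∀ i → NonTrivial (Gs i)) (connected : ∀ i → Connected (Gs i))
             {N : ℕ} (G : Graph N) (P : PointAttaching Gs G) where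

  open Gates Gs nontrivial connected G P public

  avoiding⇒removed : ∀ j {x u v} → V j x → Avoiding j u v → RemovedAdj P j x u v
  avoiding⇒removed j {x} vx (i , i≢j , e) =
    edgeOf⇒adj e ,
    (λ { (refl , vjv) → adj⇒≢ (edgeOf⇒adj e) (share-one i≢j (edgeOf-src e) vx (edgeOf-tgt e) vjv) }) ,
    (λ { (refl , vju) → adj⇒≢ (edgeOf⇒adj e) (sym (share-one i≢j (edgeOf-tgt e) vx (edgeOf-src e) vju)) })

  removed⇒avoiding : ∀ j {x v l} → V j x → Walk (RemovedAdj P j x) x v l → Walk (Avoiding j) x v l
  removed⇒avoiding j {x} vx = continue []
    where
    -- the walk walked so far avoids G_j, so its current end is x or outside G_j
    continue : ∀ {c v q l} → Walk (Avoiding j) x c q → Walk (RemovedAdj P j x) c v l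
             → Walk (Avoiding j) x v (q + l)
    continue {q = q} done [] = subst (Walk (Avoiding j) _ _) (sym (+-identityʳ q)) done
    continue {q = q} done (_∷_ {ℓ = l} (adj , not-from-x , _) rest) with adj⇒edgeOf adj
    ... | i , e with i ≟ᶠ j
    ...   | yes refl = ⊥-elim (not-from-x (sym (separation i vx (edgeOf-src e) done) , edgeOf-tgt e))
    ...   | no i≢j = subst (Walk (Avoiding j) _ _) (sym (+-suc q l)) (continue (done ∷ʳ (i , i≢j , e)) rest)

  removed-sym : ∀ j x {u v} → RemovedAdj P j x u v → RemovedAdj P j x v u
  removed-sym j x (adj , not-from-x , not-to-x) = adj-sym adj , not-to-x , not-from-x

  OddAvoiding : (j : Fin (suc k)) → Fin N → Set
  OddAvoiding j x = Σ ℕ λ l → Walk (Avoiding j) x x l × parity l ≡ true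

  odd-at-C : ∀ j a → ¬ PlusComponentBipartite P j (emb j a) → ¬ ¬ OddAvoiding j (emb j a)
  odd-at-C j a not-bip = ¬¬-decidable N (InPlusComponent P j x) >>= λ reachable? no-odd →
    not-bip (ComponentColouring.colouring (RemovedAdj P j x) (removed-sym j x) x reachable?
               λ { (l , w , odd) → no-odd (l , removed⇒avoiding j (a , refl) w , odd) })
    where x = emb j a

  odd-closed-walk : ¬ Bipartite G → ¬ ¬ (Σ ℕ λ l → Walk (Adj G) root root l × parity l ≡ true)
  odd-closed-walk not-bip no-odd
    with ComponentColouring.colouring (Adj G) adj-sym root (λ u → yes (reach u)) no-odd
  ... | c , proper = not-bip (c , λ u v e → proper u v (reach u) e)

  odd-piece : ∀ {i c} → OddIn i c → Σ (Fin (sizes i)) λ c₀ → emb i c₀ ≡ c × ¬ Bipartite (Gs i)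
  odd-piece (zero , [] , ())
  odd-piece {i} (suc l , w@((a , _ , ea , _) ∷ _) , odd) =
    a , ea , Piece.odd-closed-walk⇒¬bipartite i (restrict-walk i w (sym ea) (sym ea)) odd

  reaches-odd⇒C : ∀ j i g {v l} → j ≢ i → ¬ Bipartite (Gs i)
                → Walk (Avoiding j) (emb j g) v l → V i v → InC P j g
  reaches-odd⇒C j i g {v} j≢i not-bip w (b , refl) = attachment w (b , refl) , plus-not-bipartite
    where
    x = emb j g
    attachment : ∀ {u l} → Walk (Avoiding j) x u l → V i u → AttachmentVertex P x
    attachment [] vi = j , i , j≢i , (g , refl) , vi
    attachment ((i' , i'≢j , e) ∷ _) _ = j , i' , (λ eq → i'≢j (sym eq)) , (g , refl) , edgeOf-src e
    into-Gi : ∀ a → InPlusComponent P j x (emb i a)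
    into-Gi a = _ , weakenʷ (avoiding⇒removed j (g , refl))
                      (w ++ʷ proj₂ (avoiding-path i j (λ eq → j≢i (sym eq)) b a))
    -- a bipartition of G_j(x⁺) would restrict to one of G_i
    plus-not-bipartite : ¬ PlusComponentBipartite P j x
    plus-not-bipartite (c , proper) = not-bip ((λ a → c (emb i a)) , λ a a' e →
      proper _ _ (into-Gi a)
        (avoiding⇒removed j (g , refl) (i , (λ eq → j≢i (sym eq)) , a , a' , refl , refl , e)))

  gates-comparable : ∀ j₁ j₂ w → j₁ ≢ j₂
    → (∃ λ l → Walk (Avoiding j₁) (emb j₁ (gate j₁ w)) (emb j₂ (gate j₂ w)) l)
      ⊎ (∃ λ l → Walk (Avoiding j₂) (emb j₂ (gate j₂ w)) (emb j₁ (gate j₁ w)) l)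
  gates-comparable j₁ j₂ w j₁≢j₂ = conclude (scan [] (proj₂ (gate-walk j₂ w)))
    where
    Scan : Fin N → Set
    Scan t = (∃ λ l → Walk (Avoiding j₁) w t l)
             ⊎ (Σ (Fin N) λ h → V j₁ h × (∃ λ l → Walk (Avoiding j₁) w h l)
                                         × (∃ λ l → Walk (Avoiding j₂) h t l))
    scan : ∀ {u t l l'} → Walk (Avoiding j₁) w u l' → Walk (Avoiding j₂) u t l → Scan t
    scan done [] = inj₁ (_ , done)
    scan done (e@(i , i≢j₂ , e') ∷ rest) with i ≟ᶠ j₁
    ... | yes refl = inj₂ (_ , edgeOf-src e' , (_ , done) , (_ , e ∷ rest))
    ... | no i≢j₁ = scan (done ∷ʳ (i , i≢j₁ , e')) rest
    conclude : Scan (emb j₂ (gate j₂ w)) → _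
    conclude (inj₁ (_ , w→g₂)) = inj₁ (_ , reverseʷ edgeIn-sym (proj₂ (gate-walk j₁ w)) ++ʷ w→g₂)
    conclude (inj₂ (_ , (a , refl) , (_ , w→h) , (_ , h→g₂))) with gate-unique j₁ w→h
    ... | refl = inj₂ (_ , reverseʷ edgeIn-sym h→g₂)

  gate-nearest : ∀ i t x → t ≢ gate i x → dist (emb i (gate i x)) x < dist (emb i t) x
  gate-nearest i t x t≢g = subst (dist (emb i g) x <_)
    (dist-unique (dist-via-gate i t x) (dist-ok (emb i t) x))
    (m<n+m _ (Piece.dist-pos i t≢g (PieceDist.dist-ok i t g)))
    where g = gate i x

  beyond-gate : ∀ i v x → gate i v ≢ gate i x → dist (emb i (gate i v)) x ≤ dist v x
  beyond-gate i v x gates≢ with through-gate i (proj₁ (dist-ok x v))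
  ... | inj₁ (_ , avoid) = ⊥-elim (gates≢ (gate-move i avoid))
  ... | inj₂ (m₁ , m₂ , eq , x→g , _) = begin
    dist (emb i (gate i v)) x  ≡⟨ dist-comm _ x ⟩
    dist x (emb i (gate i v))  ≤⟨ dist-≤-walk (dist-ok x _) x→g ⟩
    m₁                         ≤⟨ m≤m+n m₁ m₂ ⟩
    m₁ + m₂                    ≡⟨ eq ⟩
    dist x v                   ≡⟨ dist-comm x v ⟩
    dist v x                   ∎
    where open ≤-Reasoning

  OddBeyond : (j : Fin (suc k)) → Fin (sizes j) → Fin (suc k) → Set
  OddBeyond j z i = i ≢ j × Σ (Fin N) λ c → OddIn i c × ∃ λ p → Walk (Avoiding j) (emb j z) c p

  odd-beyond-C : ∀ j z → InC P j z → ¬ ¬ Σ (Fin (suc k)) (OddBeyond j z)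
  odd-beyond-C j z (_ , not-bip) =
    (λ { (_ , w , odd) → localise-odd (λ i → i ≢ j) w odd }) <$> odd-at-C j z not-bip

  depth : (j : Fin (suc k)) → Fin (sizes j) → Fin (suc k) → ℕ
  depth j z i = dist (emb i (gate i (emb j z))) (emb j z)

  -- All of G_i lies
  -- beyond z, and C_i is at most the gate y of emb j z in G_i: an odd walk
  -- hanging off G_i at any other vertex would lead to a deeper odd subgraph.
  module Deepest (j : Fin (suc k)) (z : Fin (sizes j)) (i : Fin (suc k)) (i≢j : i ≢ j)
                 (c₀ : Fin (sizes i)) (to-c₀ : ∃ λ p → Walk (Avoiding j) (emb j z) (emb i c₀) p)
                 (deepest : ∀ i' → OddBeyond j z i' → depth j z i' ≤ depth j z i) where

    x = emb j z
    y = gate i x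

    to-piece : ∀ s → ∃ λ p → Walk (Avoiding j) x (emb i s) p
    to-piece s = _ , proj₂ to-c₀ ++ʷ proj₂ (avoiding-path i j i≢j c₀ s)

    beyond-z : ∀ s → gate j (emb i s) ≡ z
    beyond-z s = trans (gate-move j (proj₂ (to-piece s))) (gate-self j z)

    gate-of-Gj : ∀ v → V j v → gate i v ≡ y
    gate-of-Gj v (b , refl) = gate-move i (proj₂ (avoiding-path j i (λ eq → i≢j (sym eq)) z b))

    -- an odd subgraph beyond a vertex t ≠ y of G_i would be deeper than G_i
    no-deeper : ∀ t → t ≢ y → ¬ Σ (Fin (suc k)) (OddBeyond i t)
    no-deeper t t≢y (i' , i'≢i , _ , odd' , _ , t→c') with odd-piece odd'
    ... | c₀' , refl , _ = <-irrefl refl (≤-<-trans (deepest i' beyond') farther)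
      where
      gate-t : ∀ {v l} → Walk (Avoiding i) (emb i t) v l → gate i v ≡ t
      gate-t w = trans (gate-move i w) (gate-self i t)
      -- leaving G_i at t, one never meets G_j (whose gate in G_i is y ≠ t)
      avoids-j : ∀ {u v l l'} → Walk (Avoiding i) (emb i t) u l' → Walk (Avoiding i) u v l
               → Walk (Avoiding j) u v l
      avoids-j done [] = []
      avoids-j done ((i'' , i''≢i , e) ∷ rest) with i'' ≟ᶠ j
      ... | yes refl = ⊥-elim (t≢y (trans (sym (gate-t done)) (gate-of-Gj _ (edgeOf-src e))))
      ... | no i''≢j = (i'' , i''≢j , e) ∷ avoids-j (done ∷ʳ (i'' , i''≢i , e)) rest
      i'≢j : i' ≢ j
      i'≢j refl = t≢y (trans (sym (gate-t t→c')) (gate-of-Gj _ (c₀' , refl)))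
      beyond' : OddBeyond j z i'
      beyond' = i'≢j , _ , odd' , _ , proj₂ (to-piece t) ++ʷ avoids-j [] t→c'
      g' = emb i' (gate i' x)
      gate-g' : gate i g' ≡ t
      gate-g' = gate-t (t→c' ++ʷ proj₂ (avoiding-path i' i i'≢i c₀' (gate i' x)))
      farther : depth j z i < depth j z i'
      farther = <-≤-trans (gate-nearest i t x t≢y)
        (subst (λ s → dist (emb i s) x ≤ dist g' x) gate-g'
          (beyond-gate i g' x (λ eq → t≢y (trans (sym gate-g') eq))))

    only-C : ∀ t → InC P i t → t ≡ y
    only-C t (_ , not-bip) = decidable-stable (t ≟ᶠ y) λ t≢y →
      odd-at-C i t not-bip λ { (_ , w , odd) → no-deeper t t≢y (localise-odd (λ i' → i' ≢ i) w odd) }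

  DeepPiece : (j : Fin (suc k)) → Fin (sizes j) → Set
  DeepPiece j z = Σ (Fin (suc k)) λ i → ¬ Bipartite (Gs i) × (∀ s → gate j (emb i s) ≡ z)
                  × Σ (Fin (sizes i)) λ y → ∀ t → InC P i t → t ≡ y

  deep-piece : ∀ j z → InC P j z → ¬ ¬ DeepPiece j z
  deep-piece j z inC = do
    start ← odd-beyond-C j z inC
    beyond? ← ¬¬-decidable (suc k) (OddBeyond j z)
    pure (from-deepest (argmax (OddBeyond j z) beyond? (depth j z) start))
    where
    from-deepest : (Σ (Fin (suc k)) λ i → OddBeyond j z i
                      × (∀ i' → OddBeyond j z i' → depth j z i' ≤ depth j z i))
                 → DeepPiece j z
    from-deepest (i , (i≢j , _ , odd , to-c) , deepest) with odd-piece odd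
    ... | c₀ , refl , not-bip = i , not-bip , beyond-z , y , only-C
      where open Deepest j z i i≢j c₀ to-c deepest

∑ : ∀ n → (Fin n → ℕ) → ℕ
∑ n f = sum (tabulate {n = n} f)

∑-mono : ∀ n {f g : Fin n → ℕ} → (∀ x → f x ≤ g x) → ∑ n f ≤ ∑ n g
∑-mono zero le = z≤n
∑-mono (suc n) le = +-mono-≤ (le zero) (∑-mono n (le ∘ suc))

∑-cong : ∀ n {f g : Fin n → ℕ} → (∀ x → f x ≡ g x) → ∑ n f ≡ ∑ n g
∑-cong zero eq = refl
∑-cong (suc n) eq = cong₂ _+_ (eq zero) (∑-cong n (eq ∘ suc))

∑-zero : ∀ n {f : Fin n → ℕ} → (∀ x → f x ≡ 0) → ∑ n f ≡ 0
∑-zero zero _ = refl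
∑-zero (suc n) z rewrite z zero = ∑-zero n (z ∘ suc)

∑-+ : ∀ n (f g : Fin n → ℕ) → ∑ n (λ x → f x + g x) ≡ ∑ n f + ∑ n g
∑-+ zero f g = refl
∑-+ (suc n) f g = trans (cong (f zero + g zero +_) (∑-+ n (f ∘ suc) (g ∘ suc)))
                        (interchange (f zero) (g zero) (∑ n (f ∘ suc)) (∑ n (g ∘ suc)))

∑-swap : ∀ n m (h : Fin n → Fin m → ℕ)
       → ∑ n (λ x → ∑ m (h x)) ≡ ∑ m (λ y → ∑ n (λ x → h x y))
∑-swap zero m h = sym (∑-zero m (λ _ → refl))
∑-swap (suc n) m h = trans (cong (∑ m (h zero) +_) (∑-swap n m (h ∘ suc)))
                           (sym (∑-+ m (h zero) (λ y → ∑ n (λ x → h (suc x) y))))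

∑-*ˡ : ∀ n c (f : Fin n → ℕ) → ∑ n (λ x → c * f x) ≡ c * ∑ n f
∑-*ˡ zero c f = sym (*-zeroʳ c)
∑-*ˡ (suc n) c f = trans (cong (c * f zero +_) (∑-*ˡ n c (f ∘ suc))) (sym (*-distribˡ-+ c (f zero) _))

∑-term : ∀ n (f : Fin n → ℕ) x → f x ≤ ∑ n f
∑-term (suc n) f zero = m≤m+n _ _
∑-term (suc n) f (suc x) = ≤-trans (∑-term n (f ∘ suc) x) (m≤n+m _ _)

𝟙 : Bool → ℕ
𝟙 true = 1
𝟙 false = 0

∑-at-most-one : ∀ n (b : Fin n → Bool) → (∀ x y → b x ≡ true → b y ≡ true → x ≡ y)
              → ∑ n (𝟙 ∘ b) ≤ 1
∑-at-most-one zero b unique = z≤n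
∑-at-most-one (suc n) b unique with b zero in b₀
... | false = ∑-at-most-one n (b ∘ suc) (λ x y bx by → fsuc-injective (unique (suc x) (suc y) bx by))
... | true = ≤-reflexive (cong suc (∑-zero n rest-zero))
  where rest-zero : ∀ x → 𝟙 (b (suc x)) ≡ 0
        rest-zero x with b (suc x) in bx
        ... | false = refl
        ... | true with unique zero (suc x) b₀ bx
        ...   | ()

∑-delta : ∀ n (a : Fin n) → ∑ n (λ x → 𝟙 (does (a ≟ᶠ x))) ≡ 1
∑-delta (suc n) zero = cong suc (∑-zero n (λ _ → refl))
∑-delta (suc n) (suc a) = trans (∑-cong n shift) (∑-delta n a)
  where shift : ∀ x → 𝟙 (does (suc a ≟ᶠ suc x)) ≡ 𝟙 (does (a ≟ᶠ x))
        shift x with a ≟ᶠ x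
        ... | yes refl = refl
        ... | no _ = refl

∑-weighted-delta : ∀ n c (a : Fin n) → ∑ n (λ x → c * 𝟙 (does (a ≟ᶠ x))) ≡ c
∑-weighted-delta n c a = trans (∑-*ˡ n c _) (trans (cong (c *_) (∑-delta n a)) (*-identityʳ c))

∣∣-∑ : ∀ {n} (p : Subset n) → ∣ p ∣ ≡ ∑ n (λ x → 𝟙 (lookup p x))
∣∣-∑ [] = refl
∣∣-∑ (true ∷ p) = cong suc (∣∣-∑ p)
∣∣-∑ (false ∷ p) = ∣∣-∑ p

subset : ∀ {n} {P : Fin n → Set} → (∀ x → Dec (P x)) → Subset n
subset P? = tabulateᵛ (does ∘ P?)

subset-intro : ∀ {n} {P : Fin n → Set} (P? : ∀ x → Dec (P x)) {x} → P x → x ∈ subset P?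
subset-intro P? {x} px = lookup⇒[]= x (subset P?) (trans (lookup∘tabulate (does ∘ P?) x) (dec-true (P? x) px))

subset-elim : ∀ {n} {P : Fin n → Set} (P? : ∀ x → Dec (P x)) {x} → x ∈ subset P? → P x
subset-elim P? {x} x∈ with P? x | trans (sym (lookup∘tabulate (does ∘ P?) x)) ([]=⇒lookup x∈)
... | yes px | _ = px
... | no _ | ()

covered-≤ : ∀ {N k} {n : Fin k → ℕ} (W : Subset N) (S : ∀ i → Subset (n i))
            (e : ∀ i → Fin (n i) → Fin N)
          → (∀ {w} → w ∈ W → Σ (Fin k) λ i → Σ (Fin (n i)) λ a → a ∈ S i × e i a ≡ w)
          → ∣ W ∣ ≤ ∑ k (λ i → ∣ S i ∣)
covered-≤ {N} {k} {n} W S e covered = begin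
  ∣ W ∣                                               ≡⟨ ∣∣-∑ W ⟩
  ∑ N (λ w → 𝟙 (lookup W w))                          ≤⟨ ∑-mono N hit ⟩
  ∑ N (λ w → ∑ k (λ i → ∑ (n i) (R w i)))            ≡⟨ ∑-swap N k _ ⟩
  ∑ k (λ i → ∑ N (λ w → ∑ (n i) (R w i)))            ≡⟨ ∑-cong k (λ i → ∑-swap N (n i) (λ w → R w i)) ⟩
  ∑ k (λ i → ∑ (n i) (λ a → ∑ N (λ w → R w i a)))    ≡⟨ ∑-cong k (λ i → ∑-cong (n i) (image-once i)) ⟩
  ∑ k (λ i → ∑ (n i) (λ a → 𝟙 (lookup (S i) a)))     ≡⟨ ∑-cong k (λ i → sym (∣∣-∑ (S i))) ⟩
  ∑ k (λ i → ∣ S i ∣)                                 ∎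
  where
  open ≤-Reasoning
  R : Fin N → (i : Fin k) → Fin (n i) → ℕ
  R w i a = 𝟙 (lookup (S i) a) * 𝟙 (does (e i a ≟ᶠ w))
  image-once : ∀ i a → ∑ N (λ w → R w i a) ≡ 𝟙 (lookup (S i) a)
  image-once i a = ∑-weighted-delta N (𝟙 (lookup (S i) a)) (e i a)
  hit : ∀ w → 𝟙 (lookup W w) ≤ ∑ k (λ i → ∑ (n i) (R w i))
  hit w with lookup W w in w∈W
  ... | false = z≤n
  ... | true with covered (lookup⇒[]= w W w∈W)
  ...   | i , a , a∈S , refl =
    ≤-trans (≤-reflexive (sym one)) (≤-trans (∑-term (n i) (R _ i) a) (∑-term k _ i))
    where one : R (e i a) i a ≡ 1
          one = cong₂ _*_ (cong 𝟙 ([]=⇒lookup a∈S)) (cong 𝟙 (dec-true (e i a ≟ᶠ e i a) refl))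

preimages-≤ : ∀ {N k} {n : Fin k → ℕ} (W : Subset N) (S : ∀ j → Subset (n j))
              (f : ∀ j → Fin N → Fin (n j))
            → (∀ j {a} → a ∈ S j → Σ (Fin N) λ w → w ∈ W × f j w ≡ a)
            → (∀ {w} j₁ j₂ → w ∈ W → f j₁ w ∈ S j₁ → f j₂ w ∈ S j₂ → j₁ ≡ j₂)
            → ∑ k (λ j → ∣ S j ∣) ≤ ∣ W ∣
preimages-≤ {N} {k} {n} W S f reached exclusive = begin
  ∑ k (λ j → ∣ S j ∣)                              ≤⟨ ∑-mono k per-subset ⟩
  ∑ k (λ j → ∑ N (λ w → 𝟙 (T j w)))               ≡⟨ ∑-swap k N _ ⟩
  ∑ N (λ w → ∑ k (λ j → 𝟙 (T j w)))               ≤⟨ ∑-mono N per-vertex ⟩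
  ∑ N (λ w → 𝟙 (lookup W w))                       ≡⟨ sym (∣∣-∑ W) ⟩
  ∣ W ∣                                            ∎
  where
  open ≤-Reasoning
  T : (j : Fin k) → Fin N → Bool
  T j w = lookup W w ∧ lookup (S j) (f j w)
  R : (j : Fin k) → Fin (n j) → Fin N → ℕ
  R j a w = 𝟙 (T j w) * 𝟙 (does (f j w ≟ᶠ a))
  reached-once : ∀ j a → 𝟙 (lookup (S j) a) ≤ ∑ N (R j a)
  reached-once j a with lookup (S j) a in a∈S
  ... | false = z≤n
  ... | true with reached j (lookup⇒[]= a (S j) a∈S)
  ...   | w , w∈W , refl = ≤-trans (≤-reflexive (sym one)) (∑-term N (R j _) w)
    where one : R j (f j w) w ≡ 1
          one = cong₂ _*_ (cong 𝟙 (cong₂ _∧_ ([]=⇒lookup w∈W) a∈S))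
                          (cong 𝟙 (dec-true (f j w ≟ᶠ f j w) refl))
  per-subset : ∀ j → ∣ S j ∣ ≤ ∑ N (λ w → 𝟙 (T j w))
  per-subset j = begin
    ∣ S j ∣                                          ≡⟨ ∣∣-∑ (S j) ⟩
    ∑ (n j) (λ a → 𝟙 (lookup (S j) a))               ≤⟨ ∑-mono (n j) (reached-once j) ⟩
    ∑ (n j) (λ a → ∑ N (R j a))                      ≡⟨ ∑-swap (n j) N _ ⟩
    ∑ N (λ w → ∑ (n j) (λ a → R j a w))              ≡⟨ ∑-cong N (λ w → ∑-weighted-delta (n j) _ (f j w)) ⟩
    ∑ N (λ w → 𝟙 (T j w))                           ∎
  per-vertex : ∀ w → ∑ k (λ j → 𝟙 (T j w)) ≤ 𝟙 (lookup W w)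
  per-vertex w with lookup W w in w∈W
  ... | false = ≤-reflexive (∑-zero k λ _ → refl)
  ... | true = ∑-at-most-one k (λ j → lookup (S j) (f j w)) λ j₁ j₂ t₁ t₂ →
    exclusive j₁ j₂ (lookup⇒[]= w W w∈W) (lookup⇒[]= _ (S j₁) t₁) (lookup⇒[]= _ (S j₂) t₂)

module LocalDimension {k : ℕ} {sizes : Fin (suc k) → ℕ} (Gs : (i : Fin (suc k)) → Graph (sizes i))
       (nontrivial : ∀ i → NonTrivial (Gs i)) (connected : ∀ i → Connected (Gs i))
       {N : ℕ} (G : Graph N) (P : PointAttaching Gs G) (non-bipartite : ¬ Bipartite G)
       (ρ : Fin (suc k) → ℕ) (ρ-bipartite : ∀ j → Bipartite (Gs j) → ρ j ≡ 0)
       (ρ-rho : ∀ j → ¬ Bipartite (Gs j) → IsRho P j (ρ j)) where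

  open OddCycles Gs nontrivial connected G P

  IsGenerator : Subset N → Set
  IsGenerator W = IsLocalMetricGenerator G (_∈ W)

  generator? : ∀ W → Dec (IsGenerator W)
  generator? W = all? λ u → all? λ v → adj? u v →-dec any? (λ w → (w ∈? W) ×-dec resolves? w u v)

  -- Lower bound.  The gates of a generator W in a non-bipartite G_j, outside
  -- C_j, complete C_j to a local metric generator of G_j; each w ∈ W serves
  -- this way at most one G_j.
  module Lower (W : Subset N) (gen : IsGenerator W)
               (C? : ∀ j a → Dec (InC P j a)) (bipartite? : ∀ j → Dec (Bipartite (Gs j))) where

    Served : (j : Fin (suc k)) → Fin (sizes j) → Set
    Served j a = ¬ Bipartite (Gs j) × ¬ InC P j a × Σ (Fin N) λ w → w ∈ W × gate j w ≡ a

    served? : ∀ j a → Dec (Served j a)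
    served? j a = ¬? (bipartite? j) ×-dec ¬? (C? j a) ×-dec any? (λ w → (w ∈? W) ×-dec (gate j w ≟ᶠ a))

    S : ∀ j → Subset (sizes j)
    S j = subset (served? j)

    ρ≤∣S∣ : ∀ j → ρ j ≤ ∣ S j ∣
    ρ≤∣S∣ j = by-cases (bipartite? j)
      where
      by-cases : Dec (Bipartite (Gs j)) → ρ j ≤ ∣ S j ∣
      by-cases (yes bip) = subst (_≤ ∣ S j ∣) (sym (ρ-bipartite j bip)) z≤n
      by-cases (no not-bip) = proj₂ (ρ-rho j not-bip) (S j) completes
        where
        completes : IsLocalMetricGenerator (Gs j) (λ a → a ∈ S j ⊎ InC P j a)
        completes a b e with gen (emb j a) (emb j b) (embed-edge j e)
        ... | w , w∈W , res with C? j (gate j w)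
        ...   | yes inC = gate j w , inj₂ inC , resolves-to-gate j w res
        ...   | no ¬inC = gate j w , inj₁ (subset-intro (served? j) (not-bip , ¬inC , w , w∈W , refl))
                        , resolves-to-gate j w res

    -- two served gates of one vertex would make one of them a C-vertex
    exclusive : ∀ {w} j₁ j₂ → w ∈ W → gate j₁ w ∈ S j₁ → gate j₂ w ∈ S j₂ → j₁ ≡ j₂
    exclusive {w} j₁ j₂ _ s₁ s₂
      with j₁ ≟ᶠ j₂ | subset-elim (served? j₁) s₁ | subset-elim (served? j₂) s₂
    ... | yes j₁≡j₂ | _ | _ = j₁≡j₂
    ... | no j₁≢j₂ | not-bip₁ , ¬C₁ , _ | not-bip₂ , ¬C₂ , _ with gates-comparable j₁ j₂ w j₁≢j₂
    ...   | inj₁ (_ , walk) = ⊥-elim (¬C₁ (reaches-odd⇒C j₁ j₂ _ j₁≢j₂ not-bip₂ walk (_ , refl)))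
    ...   | inj₂ (_ , walk) = ⊥-elim (¬C₂ (reaches-odd⇒C j₂ j₁ _ (≢-sym j₁≢j₂) not-bip₁ walk (_ , refl)))

    lower-bound : ∑ (suc k) ρ ≤ ∣ W ∣
    lower-bound = ≤-trans (∑-mono (suc k) ρ≤∣S∣) (preimages-≤ W S gate served-by exclusive)
      where
      served-by : ∀ j {a} → a ∈ S j → Σ (Fin N) λ w → w ∈ W × gate j w ≡ a
      served-by j a∈S = proj₂ (proj₂ (subset-elim (served? j) a∈S))

  lower : ∀ W → IsGenerator W → ∑ (suc k) ρ ≤ ∣ W ∣
  lower W gen = decidable-stable (∑ (suc k) ρ ≤? ∣ W ∣) do
    C? ← ¬¬-∀Fin (suc k) (λ j → ¬¬-decidable (sizes j) (InC P j))
    bipartite? ← ¬¬-∀Fin (suc k) (λ j → ¬¬-excluded-middle)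
    pure (Lower.lower-bound W gen C? bipartite?)

  -- W is the union of optimal completions S_i (empty when G_i is
  -- bipartite).  An edge of a bipartite G_j is resolved by any vertex, an
  -- edge of a non-bipartite G_j by a vertex of S_j or of C_j, and a vertex of
  -- C_j is the gate of a vertex of S_i for a deep piece G_i beyond it.
  module Upper (bipartite? : ∀ j → Dec (Bipartite (Gs j))) where

    Completion : Fin (suc k) → Set
    Completion i = Σ (Subset (sizes i)) λ S →
      (¬ Bipartite (Gs i) → IsLocalMetricGenerator (Gs i) (λ a → a ∈ S ⊎ InC P i a)) × ∣ S ∣ ≤ ρ i

    completion : ∀ i → Completion i
    completion i with bipartite? i
    ... | yes bip = ∅ , (λ not-bip → ⊥-elim (not-bip bip)) , subst (_≤ ρ i) (sym (∣⊥∣≡0 (sizes i))) z≤n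
    ... | no not-bip with ρ-rho i not-bip
    ...   | (S , gen , size) , _ = S , (λ _ → gen) , ≤-reflexive size

    S : ∀ i → Subset (sizes i)
    S i = proj₁ (completion i)

    completes : ∀ i → ¬ Bipartite (Gs i) → IsLocalMetricGenerator (Gs i) (λ a → a ∈ S i ⊎ InC P i a)
    completes i = proj₁ (proj₂ (completion i))

    InW : Fin N → Set
    InW w = Σ (Fin (suc k)) λ i → Σ (Fin (sizes i)) λ a → a ∈ S i × emb i a ≡ w

    inW? : ∀ w → Dec (InW w)
    inW? w = any? λ i → any? λ a → (a ∈? S i) ×-dec (emb i a ≟ᶠ w)

    W : Subset N
    W = subset inW?

    emb-∈W : ∀ i a → a ∈ S i → emb i a ∈ W
    emb-∈W i a a∈S = subset-intro inW? (i , a , a∈S , refl)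

    ∣W∣≤∑ρ : ∣ W ∣ ≤ ∑ (suc k) ρ
    ∣W∣≤∑ρ = ≤-trans (covered-≤ W S emb (subset-elim inW?))
                     (∑-mono (suc k) (λ i → proj₂ (proj₂ (completion i))))

    -- S_i is nonempty when G_i is non-bipartite and C_i ⊆ {y}:
    -- otherwise y alone would resolve every edge of G_i
    S-nonempty : ∀ i → ¬ Bipartite (Gs i) → ∀ y → (∀ t → InC P i t → t ≡ y)
               → ¬ ¬ Σ (Fin (sizes i)) (_∈ S i)
    S-nonempty i not-bip y only-y none = not-bip (PieceDist.single-resolver⇒bipartite i y by-y)
      where
      by-y : ∀ a b → Adj (Gs i) a b → Resolves (Gs i) y a b
      by-y a b e with completes i not-bip a b e
      ... | t , inj₁ t∈S , _ = ⊥-elim (none (t , t∈S))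
      ... | t , inj₂ inC , res = subst (λ v → Resolves (Gs i) v a b) (only-y t inC) res

    C-reached : ∀ j t → InC P j t → ¬ ¬ Σ (Fin N) λ w → w ∈ W × gate j w ≡ t
    C-reached j t inC = do
      i , not-bip , beyond , y , only-y ← deep-piece j t inC
      s , s∈S ← S-nonempty i not-bip y only-y
      pure (emb i s , emb-∈W i s s∈S , beyond s)

    -- W is nonempty: an odd closed walk of G localises in a non-bipartite
    -- G_i, and an edge of G_i is resolved by a vertex of S_i or of C_i
    W-nonempty : ¬ ¬ Σ (Fin N) (_∈ W)
    W-nonempty = do
      _ , w , odd ← odd-closed-walk non-bipartite
      from-odd (localise-odd (λ _ → ⊤) (weakenʷ (λ e → let i , e' = adj⇒edgeOf e in i , tt , e') w) odd)
      where
      from-odd : ReachesOdd (λ _ → ⊤) root → ¬ ¬ Σ (Fin N) (_∈ W)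
      from-odd (_ , _ , _ , (_ , [] , ()) , _)
      from-odd (i , _ , _ , odd@(_ , (a , b , _ , _ , e) ∷ _ , _) , _)
        with completes i (proj₂ (proj₂ (odd-piece odd))) a b e
      ... | t , inj₁ t∈S , _ = pure (emb i t , emb-∈W i t t∈S)
      ... | t , inj₂ inC , _ = (λ (w , w∈W , _) → w , w∈W) <$> C-reached i t inC

    resolved : ∀ u v → Adj G u v → ¬ ¬ Σ (Fin N) λ w → w ∈ W × Resolves G w u v
    resolved u v e with adj⇒edgeOf e
    ... | j , a , b , refl , refl , e' with bipartite? j
    ...   | yes bip =
      (λ (w , w∈W) → w , w∈W , resolves-from-gate j w refl (Piece.bipartite-resolves j bip _ a b e')) <$> W-nonempty
    ...   | no not-bip with completes j not-bip a b e'
    ...     | t , inj₁ t∈S , res = pure (emb j t , emb-∈W j t t∈S , resolves-from-gate j _ (gate-self j t) res)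
    ...     | t , inj₂ inC , res =
      (λ (w , w∈W , g≡t) → w , w∈W , resolves-from-gate j w g≡t res) <$> C-reached j t inC

    W-generator : IsGenerator W
    W-generator u v e = decidable-stable (any? λ w → (w ∈? W) ×-dec resolves? w u v) (resolved u v e)

  upper : ¬ ¬ Σ (Subset N) λ W → IsGenerator W × ∣ W ∣ ≤ ∑ (suc k) ρ
  upper = (λ bipartite? → Upper.W bipartite? , Upper.W-generator bipartite? , Upper.∣W∣≤∑ρ bipartite?)
          <$> ¬¬-∀Fin (suc k) (λ _ → ¬¬-excluded-middle)

  dimension : LocalMetricDimension G (∑ (suc k) ρ)
  dimension = decidable-stable (anySubset? λ W → generator? W ×-dec (∣ W ∣ ≟ ∑ (suc k) ρ))
                ((λ (W , gen , ∣W∣≤) → W , gen , ≤-antisym ∣W∣≤ (lower W gen)) <$> upper)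
            , lower

theorem5 : (k : ℕ) (sizes : Fin k → ℕ) (Gs : (i : Fin k) → Graph (sizes i))
           → (∀ i → NonTrivial (Gs i)) → (∀ i → Connected (Gs i))
           → (N : ℕ) (G : Graph N) (P : PointAttaching Gs G)
           → ¬ Bipartite G
           → (ρ : Fin k → ℕ)
           → (∀ j → Bipartite (Gs j) → ρ j ≡ 0)
           → (∀ j → ¬ Bipartite (Gs j) → IsRho P j (ρ j))
           → LocalMetricDimension G (sum (tabulate ρ))
theorem5 zero sizes Gs _ _ N G P non-bipartite _ _ _ =
  ⊥-elim (non-bipartite ((λ _ → false) , λ u _ _ → ⊥-elim (no-vertex u)))
  where
  -- with no primary subgraphs, G has no vertices
  no-vertex : Fin N → ⊥
  no-vertex u with PointAttaching.cover P u
  ... | () , _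
theorem5 (suc k) sizes Gs nontrivial connected N G P non-bipartite ρ ρ-bipartite ρ-rho =
  LocalDimension.dimension Gs nontrivial connected G P non-bipartite ρ ρ-bipartite ρ-rho
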